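{- Suppose $\det(\nu_{i+j,n})_{i,j=0}^{n}\neq0$ for all $n\ge0$. Then for every $n\ge0$, \[ \det(\nu_{i+j,j})_{0\le i,j\le n}=\prod_{k=1}^n\frac{\lambda_k^k}{(-a_k)^kP_k(-\lambda_k/a_k)},\qquad \det(\nu_{i,j})_{0\le i,j\le n}=\prod_{k=1}^n\frac{1}{P_k(-\lambda_k/a_k)}. \]
   Context: Let $\{b_n\}_{n\ge0},\{a_n\}_{n\ge0},\{\lambda_n\}_{n\ge0}$ be sequences of complex numbers. Define monic polynomials $P_n(x)$ by $P_{ -1}(x)=0$, $P_0(x)=1$ and $P_{n+1}(x)=(x-b_n)P_n(x)-(a_nx+\lambda_n)P_{n-1}(x)$ for $n\ge0$. Let $d_0(x)=1$, $d_m(x)=\prod_{i=1}^m(a_ix+\lambda_i)$, and $Q_m(x)=P_m(x)/d_m(x)$. Assume $a_n\neq0$ and $P_n(-\lambda_n/a_n)\neq 0$ for all $n\ge1$. Let $V=\mathrm{span}\{x^nQ_m(x):n,m\ge0\}$ (rational functions; it contains every $x^n/d_m(x)$), and let $\mathcal{L}$ be the unique linear functional on $V$ with $\mathcal{L}(1)=1$ and $\mathcal{L}(x^nQ_m(x))=0$ whenever $0\le n<m$. Set $\nu_{n,m}=\mathcal{L}(x^n/d_m(x))$. -}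

module Defs where

open import Level using (Level; _⊔_) renaming (suc to lsuc)
open import Data.Nat using (ℕ; zero; suc; _<_) renaming (_+_ to _+ℕ_)
open import Data.Fin using (Fin; toℕ; punchIn) renaming (zero to fzero; suc to fsuc)
open import Data.Product using (_×_; _,_; proj₁; proj₂)
open import Relation.Nullary using (¬_)
open import Algebra.Bundles using (CommutativeRing)

-- A field: a commutative ring (with setoid equality ≈) together with an
-- inverse operation that is a genuine inverse on nonzero elements.
-- (The value of 0 ⁻¹ is irrelevant; it never occurs in the statement
-- except behind a nonvanishing hypothesis.)
record Field (c ℓ : Level) : Set (lsuc (c ⊔ ℓ)) where
  field
    commutativeRing : CommutativeRing c ℓ
  open CommutativeRing commutativeRing public
  field
    _⁻¹      : Carrier → Carrier
    ⁻¹-cong  : ∀ {x y} → x ≈ y → x ⁻¹ ≈ y ⁻¹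
    inverseʳ : ∀ x → ¬ (x ≈ 0#) → x * (x ⁻¹) ≈ 1#
    0≉1      : ¬ (0# ≈ 1#)
  infix 8 _⁻¹

module FieldDefs {c ℓ : Level} (F : Field c ℓ) where
  open Field F

  pow : Carrier → ℕ → Carrier
  pow x zero    = 1#
  pow x (suc n) = pow x n * x

  sumTo : ℕ → (ℕ → Carrier) → Carrier
  sumTo zero    f = 0#
  sumTo (suc n) f = sumTo n f + f n

  sumFin : (n : ℕ) → (Fin n → Carrier) → Carrier
  sumFin zero    f = 0#
  sumFin (suc n) f = f fzero + sumFin n (λ i → f (fsuc i))

  prod1 : ℕ → (ℕ → Carrier) → Carrier
  prod1 zero    f = 1#
  prod1 (suc n) f = prod1 n f * f (suc n)

  det : (n : ℕ) → (Fin n → Fin n → Carrier) → Carrier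
  det zero    M = 1#
  det (suc n) M =
    sumFin (suc n) (λ j → pow (- 1#) (toℕ j) * M fzero j
                           * det n (λ i k → M (fsuc i) (punchIn j k)))

  -- Evaluation of P_{n-1}(x), P_n(x)  (P_{-1} = 0, P_0 = 1,
  -- P_{n+1} = (x - b_n) P_n - (a_n x + lam_n) P_{n-1}).
  evalPair : (b a lam : ℕ → Carrier) → ℕ → Carrier → Carrier × Carrier
  evalPair b a lam zero    x = 0# , 1#
  evalPair b a lam (suc n) x =
    let p = proj₁ (evalPair b a lam n x)
        q = proj₂ (evalPair b a lam n x)
    in q , ((x + - b n) * q + - ((a n * x + lam n) * p))

  P : (b a lam : ℕ → Carrier) → ℕ → Carrier → Carrier
  P b a lam n x = proj₂ (evalPair b a lam n x)

  -- multiplication by x on coefficient sequences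
  shift : (ℕ → Carrier) → ℕ → Carrier
  shift f zero    = 0#
  shift f (suc k) = f k

  -- Coefficient sequences of P_{n-1} and P_n (coefficient of x^k at k).
  coeffPair : (b a lam : ℕ → Carrier) → ℕ → (ℕ → Carrier) × (ℕ → Carrier)
  coeffPair b a lam zero = (λ _ → 0#) , δ
    where
    δ : ℕ → Carrier
    δ zero    = 1#
    δ (suc _) = 0#
  coeffPair b a lam (suc n) =
    let p = proj₁ (coeffPair b a lam n)
        q = proj₂ (coeffPair b a lam n)
    in q , (λ k → (shift q k + - (b n * q k)) + - (a n * shift p k + lam n * p k))

  coeffP : (b a lam : ℕ → Carrier) → ℕ → ℕ → Carrier
  coeffP b a lam m k = proj₂ (coeffPair b a lam m) k

  -- ν : ℕ → ℕ → Carrier is the moment family ν_{n,m} = L(x^n / d_m) of the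
  -- linear functional L from the paper.  A linear functional on
  -- V = span{x^n / d_m} is the same thing as a family ν satisfying the
  -- relations x^n/d_m = a_{m+1} x^{n+1}/d_{m+1} + lam_{m+1} x^n/d_{m+1}
  -- (these generate all linear relations among the x^n/d_m).
  -- L(x^n Q_m) = Σ_{k=0}^{m} [x^k]P_m · ν_{n+k,m}.
  record IsMomentFunctional (b a lam : ℕ → Carrier) (ν : ℕ → ℕ → Carrier)
         : Set ℓ where
    field
      consistent : ∀ n m →
        ν n m ≈ a (suc m) * ν (suc n) (suc m) + lam (suc m) * ν n (suc m)
      normalised : ν 0 0 ≈ 1#
      orthogonal : ∀ n m → n < m →
        sumTo (suc m) (λ k → coeffP b a lam m k * ν (n +ℕ k) m) ≈ 0#

-- Let r_j = -lam_j / a_j be the zero of a_j x + lam_j. By partial fractions,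
-- x^k / d_j ≡ r_j^k / d_j modulo 1/d_0, ..., 1/d_(j-1) whenever k ≤ j. Applying L,
-- column j of (L(x^i Q_j))_{i,j} is P_j(r_j) times column j of (ν_{i,j}) plus a
-- combination of earlier columns, and column j of (ν_{i+j,j}) is r_j^j times column j
-- of (ν_{i,j}) plus earlier columns; so both determinants are the products of these
-- factors times det(ν_{i,j}). Orthogonality makes (L(x^i Q_j)) lower triangular, and
-- the three-term recurrence gives L(x^j Q_j) = 1, so its determinant is 1. Hence
-- det(ν_{i,j}) = ∏ 1/P_k(r_k), and then det(ν_{i+j,j}) = ∏ r_k^k / P_k(r_k).

module Submission where

open import Defs
open import Level using (Level; _⊔_)
open import Data.Nat using (ℕ; suc) renaming (_+_ to _+ℕ_)
open import Data.Fin using (toℕ)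
open import Data.Product using (_×_)
open import Relation.Nullary using (¬_)

open import Algebra.Bundles using (CommutativeRing)
open import Algebra.Solver.Ring.AlmostCommutativeRing using (fromCommutativeRing; _-Raw-AlmostCommutative⟶_)
import Algebra.Solver.Ring as RingSolver
open import Data.Empty using (⊥-elim)
open import Data.Fin as Fin using (Fin; punchIn; punchOut) renaming (zero to fzero; suc to fsuc)
import Data.Fin.Properties as FinP
open import Data.Integer as ℤ using (ℤ; +_; -[1+_]; _⊖_; ∣_∣; _◃_)
import Data.Integer.Properties as ℤP
open import Data.Maybe using (Maybe; just; nothing)
import Data.Nat as ℕ
import Data.Nat.Properties as ℕP
open import Data.Product using (_,_; proj₁; proj₂)
open import Data.Sign as Sign using (Sign)
open import Data.Sum using (_⊎_; inj₁; inj₂)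
open import Function using (_∘_)
open import Relation.Binary.PropositionalEquality as Eq using (_≡_; _≢_; ≢-sym)
open import Relation.Nullary using (Dec; yes; no)

-- Ring solver over any commutative ring, with coefficients in ℤ so that
-- constants such as 0 and -1 normalise.
module IntegerCoefficients {c ℓ} (R : CommutativeRing c ℓ) where
  open CommutativeRing R
  open import Algebra.Properties.Ring ring using (-‿involutive; -‿+-comm; -0#≈0#; -‿distribˡ-*)
  open import Algebra.Properties.Semiring.Mult.TCOptimised semiring using (×-homo-+; ×1-homo-*) renaming (_×_ to _×ᵣ_)
  open import Relation.Binary.Reasoning.Setoid setoid

  fromℤ : ℤ → Carrier
  fromℤ (+ n) = n ×ᵣ 1#
  fromℤ -[1+ n ] = - (suc n ×ᵣ 1#)

  ⊖-homo : ∀ m n → fromℤ (m ⊖ n) ≈ m ×ᵣ 1# + - (n ×ᵣ 1#)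
  ⊖-homo ℕ.zero ℕ.zero = sym (trans (+-congˡ -0#≈0#) (+-identityʳ _))
  ⊖-homo ℕ.zero (suc n) = sym (+-identityˡ _)
  ⊖-homo (suc m) ℕ.zero = sym (trans (+-congˡ -0#≈0#) (+-identityʳ _))
  ⊖-homo (suc m) (suc n) rewrite ℤP.[1+m]⊖[1+n]≡m⊖n m n = begin
    fromℤ (m ⊖ n)
      ≈⟨ ⊖-homo m n ⟩
    m ×ᵣ 1# + - (n ×ᵣ 1#)
      ≈⟨ sym (+-identityˡ _) ⟩
    0# + (m ×ᵣ 1# + - (n ×ᵣ 1#))
      ≈⟨ +-congʳ (sym (-‿inverseʳ 1#)) ⟩
    (1# + - 1#) + (m ×ᵣ 1# + - (n ×ᵣ 1#))
      ≈⟨ +-assoc _ _ _ ⟩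
    1# + (- 1# + (m ×ᵣ 1# + - (n ×ᵣ 1#)))
      ≈⟨ +-congˡ (trans (sym (+-assoc _ _ _)) (trans (+-congʳ (+-comm _ _)) (+-assoc _ _ _))) ⟩
    1# + (m ×ᵣ 1# + (- 1# + - (n ×ᵣ 1#)))
      ≈⟨ sym (+-assoc _ _ _) ⟩
    (1# + m ×ᵣ 1#) + (- 1# + - (n ×ᵣ 1#))
      ≈⟨ +-congˡ (-‿+-comm _ _) ⟩
    (1# + m ×ᵣ 1#) + - (1# + n ×ᵣ 1#)
      ≈⟨ sym (+-cong (×-homo-+ 1# 1 m) (-‿cong (×-homo-+ 1# 1 n))) ⟩
    suc m ×ᵣ 1# + - (suc n ×ᵣ 1#) ∎

  +-homo : ∀ i j → fromℤ (i ℤ.+ j) ≈ fromℤ i + fromℤ j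
  +-homo -[1+ m ] -[1+ n ] = begin
    - (suc (suc (m ℕ.+ n)) ×ᵣ 1#)
      ≈⟨ -‿cong (reflexive (Eq.cong (_×ᵣ 1#) (Eq.sym (ℕP.+-suc (suc m) n)))) ⟩
    - ((suc m ℕ.+ suc n) ×ᵣ 1#)
      ≈⟨ -‿cong (×-homo-+ 1# (suc m) (suc n)) ⟩
    - (suc m ×ᵣ 1# + suc n ×ᵣ 1#)
      ≈⟨ sym (-‿+-comm _ _) ⟩
    - (suc m ×ᵣ 1#) + - (suc n ×ᵣ 1#) ∎
  +-homo -[1+ m ] (+ n) = trans (⊖-homo n (suc m)) (+-comm _ _)
  +-homo (+ m) -[1+ n ] = ⊖-homo m (suc n)
  +-homo (+ m) (+ n) = ×-homo-+ 1# m n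

  sgn : Sign → Carrier
  sgn Sign.+ = 1#
  sgn Sign.- = - 1#

  ◃-homo : ∀ s n → fromℤ (s ◃ n) ≈ sgn s * (n ×ᵣ 1#)
  ◃-homo s ℕ.zero = sym (zeroʳ _)
  ◃-homo Sign.+ (suc n) = sym (*-identityˡ _)
  ◃-homo Sign.- (suc n) = trans (-‿cong (sym (*-identityˡ _))) (-‿distribˡ-* 1# _)

  sgn-homo : ∀ s t → sgn (s Sign.* t) ≈ sgn s * sgn t
  sgn-homo Sign.+ t = sym (*-identityˡ _)
  sgn-homo Sign.- Sign.+ = sym (*-identityʳ _)
  sgn-homo Sign.- Sign.- = sym (trans (sym (-‿distribˡ-* 1# _)) (trans (-‿cong (*-identityˡ _)) (-‿involutive _)))

  fromℤ-signAbs : ∀ i → fromℤ i ≈ sgn (ℤ.sign i) * (∣ i ∣ ×ᵣ 1#)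
  fromℤ-signAbs i = trans (reflexive (Eq.cong fromℤ (Eq.sym (ℤP.◃-inverse i)))) (◃-homo (ℤ.sign i) ∣ i ∣)

  *-homo : ∀ i j → fromℤ (i ℤ.* j) ≈ fromℤ i * fromℤ j
  *-homo i j = begin
    fromℤ (ℤ.sign i Sign.* ℤ.sign j ◃ ∣ i ∣ ℕ.* ∣ j ∣)
      ≈⟨ ◃-homo (ℤ.sign i Sign.* ℤ.sign j) (∣ i ∣ ℕ.* ∣ j ∣) ⟩
    sgn (ℤ.sign i Sign.* ℤ.sign j) * ((∣ i ∣ ℕ.* ∣ j ∣) ×ᵣ 1#)
      ≈⟨ *-cong (sgn-homo (ℤ.sign i) (ℤ.sign j)) (×1-homo-* ∣ i ∣ ∣ j ∣) ⟩
    (s * t) * (x * y)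
      ≈⟨ *-assoc _ _ _ ⟩
    s * (t * (x * y))
      ≈⟨ *-congˡ (trans (sym (*-assoc _ _ _)) (trans (*-congʳ (*-comm _ _)) (*-assoc _ _ _))) ⟩
    s * (x * (t * y))
      ≈⟨ sym (*-assoc _ _ _) ⟩
    (s * x) * (t * y)
      ≈⟨ sym (*-cong (fromℤ-signAbs i) (fromℤ-signAbs j)) ⟩
    fromℤ i * fromℤ j ∎
    where
    s = sgn (ℤ.sign i)
    t = sgn (ℤ.sign j)
    x = ∣ i ∣ ×ᵣ 1#
    y = ∣ j ∣ ×ᵣ 1#

  -‿homo : ∀ i → fromℤ (ℤ.- i) ≈ - fromℤ i
  -‿homo -[1+ n ] = sym (-‿involutive _)
  -‿homo (+ ℕ.zero) = sym -0#≈0#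
  -‿homo (+ suc n) = refl

  morphism : ℤ.+-*-rawRing -Raw-AlmostCommutative⟶ fromCommutativeRing R
  morphism = record
    { ⟦_⟧ = fromℤ ; +-homo = +-homo ; *-homo = *-homo ; -‿homo = -‿homo
    ; 0-homo = refl ; 1-homo = refl }

  fromℤ-equal? : ∀ i j → Maybe (fromℤ i ≈ fromℤ j)
  fromℤ-equal? i j with i ℤ.≟ j
  ... | yes i≡j = just (reflexive (Eq.cong fromℤ i≡j))
  ... | no _ = nothing

  open RingSolver ℤ.+-*-rawRing (fromCommutativeRing R) morphism fromℤ-equal? public

  :0 :1 : ∀ {n} → Polynomial n
  :0 = con (+ 0)
  :1 = con (+ 1)

data Adjacent : ∀ {n} → Fin n → Fin n → Set where
  adjacent-zero : ∀ {n} → Adjacent {suc (suc n)} fzero (fsuc fzero)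
  adjacent-suc  : ∀ {n} {p q : Fin n} → Adjacent p q → Adjacent (fsuc p) (fsuc q)

adjacent-toℕ : ∀ {n} {p q : Fin n} → Adjacent p q → toℕ q ≡ suc (toℕ p)
adjacent-toℕ adjacent-zero = Eq.refl
adjacent-toℕ (adjacent-suc a) = Eq.cong suc (adjacent-toℕ a)

adjacent-fromℕ : ∀ {n} (p q : Fin n) → toℕ q ≡ suc (toℕ p) → Adjacent p q
adjacent-fromℕ fzero (fsuc fzero) _ = adjacent-zero
adjacent-fromℕ (fsuc p) (fsuc q) e = adjacent-suc (adjacent-fromℕ p q (ℕP.suc-injective e))

adjacent-punchIn : ∀ {n} {p q : Fin (suc n)} → Adjacent p q → ∀ k →
  punchIn p k ≡ punchIn q k ⊎ (punchIn p k ≡ q × punchIn q k ≡ p)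
adjacent-punchIn adjacent-zero fzero = inj₂ (Eq.refl , Eq.refl)
adjacent-punchIn adjacent-zero (fsuc k) = inj₁ Eq.refl
adjacent-punchIn (adjacent-suc a) fzero = inj₁ Eq.refl
adjacent-punchIn (adjacent-suc a) (fsuc k) with adjacent-punchIn a k
... | inj₁ e = inj₁ (Eq.cong fsuc e)
... | inj₂ (e₁ , e₂) = inj₂ (Eq.cong fsuc e₁ , Eq.cong fsuc e₂)

adjacent-punchOut : ∀ {n} {p q j : Fin (suc n)} → Adjacent p q → (j≢p : j ≢ p) (j≢q : j ≢ q) →
  Adjacent (punchOut j≢p) (punchOut j≢q)
adjacent-punchOut {j = fzero} adjacent-zero j≢p j≢q = ⊥-elim (j≢p Eq.refl)
adjacent-punchOut {j = fsuc fzero} adjacent-zero j≢p j≢q = ⊥-elim (j≢q Eq.refl)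
adjacent-punchOut {n = suc (suc n)} {j = fsuc (fsuc j)} adjacent-zero j≢p j≢q = adjacent-zero
adjacent-punchOut {j = fzero} (adjacent-suc a) j≢p j≢q = a
adjacent-punchOut {n = suc n} {j = fsuc j} (adjacent-suc a) j≢p j≢q =
  adjacent-suc (adjacent-punchOut a (λ e → j≢p (Eq.cong fsuc e)) (λ e → j≢q (Eq.cong fsuc e)))

module Development {c ℓ} (F : Field c ℓ) where
  open Field F
  open FieldDefs F
  open IntegerCoefficients commutativeRing using (solve; _:=_; _:+_; _:*_; :-_; :0; :1)
  open import Algebra.Properties.Ring ring using (-‿involutive; -0#≈0#)
  open import Relation.Binary.Reasoning.Setoid setoid

  sumTo-cong< : ∀ n {f g : ℕ → Carrier} → (∀ k → k ℕ.< n → f k ≈ g k) → sumTo n f ≈ sumTo n g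
  sumTo-cong< ℕ.zero f≈g = refl
  sumTo-cong< (suc n) f≈g = +-cong (sumTo-cong< n (λ k k<n → f≈g k (ℕP.m<n⇒m<1+n k<n))) (f≈g n ℕP.≤-refl)

  sumTo-cong : ∀ n {f g : ℕ → Carrier} → (∀ k → f k ≈ g k) → sumTo n f ≈ sumTo n g
  sumTo-cong n f≈g = sumTo-cong< n (λ k _ → f≈g k)

  sumTo-zero : ∀ n {f : ℕ → Carrier} → (∀ k → k ℕ.< n → f k ≈ 0#) → sumTo n f ≈ 0#
  sumTo-zero ℕ.zero f≈0 = refl
  sumTo-zero (suc n) f≈0 =
    trans (+-cong (sumTo-zero n (λ k k<n → f≈0 k (ℕP.m<n⇒m<1+n k<n))) (f≈0 n ℕP.≤-refl)) (+-identityʳ 0#)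

  sumTo-linear : ∀ n x y (f g : ℕ → Carrier) →
    sumTo n (λ k → x * f k + y * g k) ≈ x * sumTo n f + y * sumTo n g
  sumTo-linear ℕ.zero x y f g =
    solve 2 (λ x y → :0 := x :* :0 :+ y :* :0) refl x y
  sumTo-linear (suc n) x y f g = trans (+-congʳ (sumTo-linear n x y f g))
    (solve 6 (λ x y s t u v → (x :* s :+ y :* t) :+ (x :* u :+ y :* v) := x :* (s :+ u) :+ y :* (t :+ v))
       refl x y (sumTo n f) (sumTo n g) (f n) (g n))

  sumTo-scale : ∀ n x (f : ℕ → Carrier) → sumTo n (λ k → x * f k) ≈ x * sumTo n f
  sumTo-scale ℕ.zero x f = sym (zeroʳ x)
  sumTo-scale (suc n) x f = trans (+-congʳ (sumTo-scale n x f)) (sym (distribˡ x _ _))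

  sumTo-front : ∀ n (f : ℕ → Carrier) → sumTo (suc n) f ≈ f 0 + sumTo n (λ k → f (suc k))
  sumTo-front ℕ.zero f = trans (+-identityˡ _) (sym (+-identityʳ _))
  sumTo-front (suc n) f = trans (+-congʳ (sumTo-front n f)) (+-assoc _ _ _)

  sumTo-extend : ∀ d n (f : ℕ → Carrier) → (∀ k → n ℕ.≤ k → f k ≈ 0#) → sumTo (d +ℕ n) f ≈ sumTo n f
  sumTo-extend ℕ.zero n f f≈0 = refl
  sumTo-extend (suc d) n f f≈0 =
    trans (+-cong (sumTo-extend d n f f≈0) (f≈0 (d +ℕ n) (ℕP.m≤n+m n d))) (+-identityʳ _)

  -- Pairs the coefficients w of a polynomial with "powers" f: the values x^k,
  -- or the moments L(x^(n+k)/d_m).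
  dot : ℕ → (ℕ → Carrier) → (ℕ → Carrier) → Carrier
  dot K w f = sumTo K (λ k → w k * f k)

  dot-linearˡ : ∀ K x y (u v f : ℕ → Carrier) →
    dot K (λ k → x * u k + y * v k) f ≈ x * dot K u f + y * dot K v f
  dot-linearˡ K x y u v f = trans
    (sumTo-cong K (λ k → solve 5 (λ x y u v f → (x :* u :+ y :* v) :* f := x :* (u :* f) :+ y :* (v :* f))
                            refl x y (u k) (v k) (f k)))
    (sumTo-linear K x y _ _)

  dot-linearʳ : ∀ K x y (w f g : ℕ → Carrier) →
    dot K w (λ k → x * f k + y * g k) ≈ x * dot K w f + y * dot K w g
  dot-linearʳ K x y w f g = trans
    (sumTo-cong K (λ k → solve 5 (λ x y w f g → w :* (x :* f :+ y :* g) := x :* (w :* f) :+ y :* (w :* g))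
                            refl x y (w k) (f k) (g k)))
    (sumTo-linear K x y _ _)

  dot-congʳ : ∀ K w {f g : ℕ → Carrier} → (∀ k → f k ≈ g k) → dot K w f ≈ dot K w g
  dot-congʳ K w f≈g = sumTo-cong K (λ k → *-congˡ (f≈g k))

  dot-shift : ∀ K (w f : ℕ → Carrier) → dot (suc K) (shift w) f ≈ dot K w (λ k → f (suc k))
  dot-shift K w f = trans (sumTo-front K _) (trans (+-congʳ (zeroˡ _)) (+-identityˡ _))

  dot-extend : ∀ d K (w f : ℕ → Carrier) → (∀ k → K ℕ.≤ k → w k ≈ 0#) → dot (d +ℕ K) w f ≈ dot K w f
  dot-extend d K w f w≈0 = sumTo-extend d K _ (λ k K≤k → trans (*-congʳ (w≈0 k K≤k)) (zeroˡ _))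

  sumFin-cong : ∀ n {f g : Fin n → Carrier} → (∀ k → f k ≈ g k) → sumFin n f ≈ sumFin n g
  sumFin-cong ℕ.zero f≈g = refl
  sumFin-cong (suc n) f≈g = +-cong (f≈g fzero) (sumFin-cong n (λ k → f≈g (fsuc k)))

  sumFin-zero : ∀ n {f : Fin n → Carrier} → (∀ k → f k ≈ 0#) → sumFin n f ≈ 0#
  sumFin-zero ℕ.zero f≈0 = refl
  sumFin-zero (suc n) f≈0 = trans (+-cong (f≈0 fzero) (sumFin-zero n (λ k → f≈0 (fsuc k)))) (+-identityʳ _)

  sumFin-linear : ∀ n x y (f g : Fin n → Carrier) →
    sumFin n (λ k → x * f k + y * g k) ≈ x * sumFin n f + y * sumFin n g
  sumFin-linear ℕ.zero x y f g =
    solve 2 (λ x y → :0 := x :* :0 :+ y :* :0) refl x y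
  sumFin-linear (suc n) x y f g = trans (+-congˡ (sumFin-linear n x y _ _))
    (solve 6 (λ x y s t u v → (x :* s :+ y :* t) :+ (x :* u :+ y :* v) := x :* (s :+ u) :+ y :* (t :+ v))
       refl x y (f fzero) (g fzero) _ _)

  sumFin-adjacent : ∀ n {f : Fin n → Carrier} {p q : Fin n} → Adjacent p q →
    (∀ j → j ≢ p → j ≢ q → f j ≈ 0#) → f p + f q ≈ 0# → sumFin n f ≈ 0#
  sumFin-adjacent (suc (suc n)) adjacent-zero others fp+fq≈0 =
    trans (+-congˡ (+-congˡ (sumFin-zero n (λ k → others (fsuc (fsuc k)) (λ ()) (λ ())))))
          (trans (+-congˡ (+-identityʳ _)) fp+fq≈0)
  sumFin-adjacent (suc n) (adjacent-suc a) others fp+fq≈0 =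
    trans (+-cong (others fzero (λ ()) (λ ()))
                  (sumFin-adjacent n a (λ j j≢p j≢q → others (fsuc j) (j≢p ∘ FinP.suc-injective) (j≢q ∘ FinP.suc-injective))
                     fp+fq≈0))
          (+-identityˡ _)

  prodTo : ℕ → (ℕ → Carrier) → Carrier
  prodTo ℕ.zero f = 1#
  prodTo (suc n) f = prodTo n f * f n

  prodTo-front : ∀ n (f : ℕ → Carrier) → prodTo (suc n) f ≈ f 0 * prodTo n (λ k → f (suc k))
  prodTo-front ℕ.zero f = trans (*-identityˡ _) (sym (*-identityʳ _))
  prodTo-front (suc n) f = trans (*-congʳ (prodTo-front n f)) (*-assoc _ _ _)

  prodTo-one : ∀ n {f : ℕ → Carrier} → (∀ k → f k ≈ 1#) → prodTo n f ≈ 1#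
  prodTo-one ℕ.zero f≈1 = refl
  prodTo-one (suc n) f≈1 = trans (*-cong (prodTo-one n f≈1) (f≈1 n)) (*-identityʳ 1#)

  prodTo-suc : ∀ n (f : ℕ → Carrier) → prodTo (suc n) f ≈ f 0 * prod1 n f
  prodTo-suc n f = trans (prodTo-front n f) (*-congˡ (shifted n))
    where
    shifted : ∀ n → prodTo n (λ k → f (suc k)) ≈ prod1 n f
    shifted ℕ.zero = refl
    shifted (suc n) = *-congʳ (shifted n)

  prod1-cong : ∀ n {f g : ℕ → Carrier} → (∀ k → f (suc k) ≈ g (suc k)) → prod1 n f ≈ prod1 n g
  prod1-cong ℕ.zero f≈g = refl
  prod1-cong (suc n) f≈g = *-cong (prod1-cong n f≈g) (f≈g n)

  prod1-* : ∀ n (f g : ℕ → Carrier) → prod1 n f * prod1 n g ≈ prod1 n (λ k → f k * g k)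
  prod1-* ℕ.zero f g = *-identityˡ 1#
  prod1-* (suc n) f g = trans
    (solve 4 (λ p x q y → (p :* x) :* (q :* y) := (p :* q) :* (x :* y)) refl (prod1 n f) (f (suc n)) (prod1 n g) (g (suc n)))
    (*-congʳ (prod1-* n f g))

  prod1-inverse : ∀ n {f : ℕ → Carrier} → (∀ k → ¬ f (suc k) ≈ 0#) → prod1 n (λ k → f k ⁻¹) * prod1 n f ≈ 1#
  prod1-inverse n f≉0 = trans (prod1-* n _ _)
    (trans (prod1-cong n (λ k → trans (*-comm _ _) (inverseʳ _ (f≉0 k)))) (one n))
    where
    one : ∀ n → prod1 n (λ _ → 1#) ≈ 1#
    one ℕ.zero = refl
    one (suc n) = trans (*-identityʳ _) (one n)

  Matrix : ℕ → Set c
  Matrix n = Fin n → Fin n → Carrier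

  minor : ∀ {n} → Matrix (suc n) → Fin (suc n) → Matrix n
  minor M j i k = M (fsuc i) (punchIn j k)

  sign : ∀ {n} → Fin n → Carrier
  sign j = pow (- 1#) (toℕ j)

  expansionTerm : ∀ {n} → Matrix (suc n) → Fin (suc n) → Carrier
  expansionTerm {n} M j = sign j * M fzero j * det n (minor M j)

  det-cong : ∀ n {M M′ : Matrix n} → (∀ i j → M i j ≈ M′ i j) → det n M ≈ det n M′
  det-cong ℕ.zero M≈M′ = refl
  det-cong (suc n) {M} {M′} M≈M′ = sumFin-cong (suc n) {expansionTerm M} {expansionTerm M′} (λ j →
    *-cong (*-congˡ (M≈M′ fzero j)) (det-cong n (λ i k → M≈M′ (fsuc i) (punchIn j k))))

  det-linear-column : ∀ n (M M₁ M₂ : Matrix n) (col : Fin n) x y →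
    (∀ i j → j ≢ col → M i j ≈ M₁ i j) → (∀ i j → j ≢ col → M i j ≈ M₂ i j) →
    (∀ i → M i col ≈ x * M₁ i col + y * M₂ i col) →
    det n M ≈ x * det n M₁ + y * det n M₂
  -- Expanding along the first row: the term at col is linear through its first-row
  -- entry, every other term through its minor.
  det-linear-column (suc n) M M₁ M₂ col x y M≈M₁ M≈M₂ M-col =
    trans (sumFin-cong (suc n) term) (sumFin-linear (suc n) x y (expansionTerm M₁) (expansionTerm M₂))
    where
    term : ∀ j → expansionTerm M j ≈ x * expansionTerm M₁ j + y * expansionTerm M₂ j
    term j with j Fin.≟ col
    ... | yes Eq.refl = begin
      sign j * M fzero j * det n (minor M j)
        ≈⟨ *-cong (*-congˡ (M-col fzero)) (det-cong n (λ i k → M≈M₁ (fsuc i) (punchIn j k) (FinP.punchInᵢ≢i j k))) ⟩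
      sign j * (x * M₁ fzero j + y * M₂ fzero j) * det n (minor M₁ j)
        ≈⟨ solve 6 (λ s x y u v d → s :* (x :* u :+ y :* v) :* d := x :* (s :* u :* d) :+ y :* (s :* v :* d))
             refl (sign j) x y (M₁ fzero j) (M₂ fzero j) (det n (minor M₁ j)) ⟩
      x * (sign j * M₁ fzero j * det n (minor M₁ j)) + y * (sign j * M₂ fzero j * det n (minor M₁ j))
        ≈⟨ +-congˡ (*-congˡ (*-congˡ (det-cong n (λ i k → trans
             (sym (M≈M₁ (fsuc i) (punchIn j k) (FinP.punchInᵢ≢i j k)))
             (M≈M₂ (fsuc i) (punchIn j k) (FinP.punchInᵢ≢i j k)))))) ⟩
      x * (sign j * M₁ fzero j * det n (minor M₁ j)) + y * (sign j * M₂ fzero j * det n (minor M₂ j)) ∎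
    ... | no j≢col = begin
      sign j * M fzero j * det n (minor M j)
        ≈⟨ *-congˡ minor-linear ⟩
      sign j * M fzero j * (x * det n (minor M₁ j) + y * det n (minor M₂ j))
        ≈⟨ solve 5 (λ s x y d₁ d₂ → s :* (x :* d₁ :+ y :* d₂) := x :* (s :* d₁) :+ y :* (s :* d₂))
             refl (sign j * M fzero j) x y _ _ ⟩
      x * (sign j * M fzero j * det n (minor M₁ j)) + y * (sign j * M fzero j * det n (minor M₂ j))
        ≈⟨ +-cong (*-congˡ (*-congʳ (*-congˡ (M≈M₁ fzero j j≢col))))
                  (*-congˡ (*-congʳ (*-congˡ (M≈M₂ fzero j j≢col)))) ⟩
      x * (sign j * M₁ fzero j * det n (minor M₁ j)) + y * (sign j * M₂ fzero j * det n (minor M₂ j)) ∎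
      where
      col′ = punchOut j≢col
      punchIn-col′ : punchIn j col′ ≡ col
      punchIn-col′ = FinP.punchIn-punchOut j≢col
      off : ∀ {k} → k ≢ col′ → punchIn j k ≢ col
      off {k} k≢col′ e = k≢col′ (FinP.punchIn-injective j k col′ (Eq.trans e (Eq.sym punchIn-col′)))
      minor-linear : det n (minor M j) ≈ x * det n (minor M₁ j) + y * det n (minor M₂ j)
      minor-linear = det-linear-column n (minor M j) (minor M₁ j) (minor M₂ j) col′ x y
        (λ i k k≢ → M≈M₁ (fsuc i) (punchIn j k) (off k≢))
        (λ i k k≢ → M≈M₂ (fsuc i) (punchIn j k) (off k≢))
        (λ i → Eq.subst (λ l → M (fsuc i) l ≈ x * M₁ (fsuc i) l + y * M₂ (fsuc i) l)
                        (Eq.sym punchIn-col′) (M-col (fsuc i)))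

  -- Expanding along the first row, the terms at p and q cancel (their minors agree
  -- and their signs differ), and every other minor has two adjacent equal columns.
  det-adjacent-equal-columns : ∀ n (M : Matrix n) {p q : Fin n} → Adjacent p q →
    (∀ i → M i p ≈ M i q) → det n M ≈ 0#
  det-adjacent-equal-columns (suc n) M {p} {q} p~q Mp≈Mq = sumFin-adjacent (suc n) p~q others cancel
    where
    others : ∀ j → j ≢ p → j ≢ q → expansionTerm M j ≈ 0#
    others j j≢p j≢q = trans (*-congˡ (det-adjacent-equal-columns n (minor M j) (adjacent-punchOut p~q j≢p j≢q)
      (λ i → trans (reflexive (Eq.cong (M (fsuc i)) (FinP.punchIn-punchOut j≢p)))
        (trans (Mp≈Mq (fsuc i)) (reflexive (Eq.cong (M (fsuc i)) (Eq.sym (FinP.punchIn-punchOut j≢q))))))))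
      (zeroʳ _)
    minors-equal : det n (minor M p) ≈ det n (minor M q)
    minors-equal = det-cong n (λ i k → entry i k (adjacent-punchIn p~q k))
      where
      entry : ∀ i k → punchIn p k ≡ punchIn q k ⊎ (punchIn p k ≡ q × punchIn q k ≡ p) →
        minor M p i k ≈ minor M q i k
      entry i k (inj₁ e) = reflexive (Eq.cong (M (fsuc i)) e)
      entry i k (inj₂ (e₁ , e₂)) = trans (reflexive (Eq.cong (M (fsuc i)) e₁))
        (trans (sym (Mp≈Mq (fsuc i))) (reflexive (Eq.cong (M (fsuc i)) (Eq.sym e₂))))
    sign-q : sign q ≈ sign p * - 1#
    sign-q = reflexive (Eq.cong (pow (- 1#)) (adjacent-toℕ p~q))
    cancel : expansionTerm M p + expansionTerm M q ≈ 0#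
    cancel = trans (+-congˡ (*-cong (*-cong sign-q (sym (Mp≈Mq fzero))) (sym minors-equal)))
      (solve 3 (λ s x d → s :* x :* d :+ s :* :- :1 :* x :* d := :0)
         refl (sign p) (M fzero p) (det n (minor M p)))

  ℕMatrix : Set c
  ℕMatrix = ℕ → ℕ → Carrier

  leadingDet : ℕ → ℕMatrix → Carrier
  leadingDet n A = det n (λ i j → A (toℕ i) (toℕ j))

  replaceColumn : ℕMatrix → ℕ → (ℕ → Carrier) → ℕMatrix
  replaceColumn A j v i k with k ℕ.≟ j
  ... | yes _ = v i
  ... | no _ = A i k

  replaceColumn-same : ∀ A j v i → replaceColumn A j v i j ≈ v i
  replaceColumn-same A j v i with j ℕ.≟ j
  ... | yes _ = refl
  ... | no j≢j = ⊥-elim (j≢j Eq.refl)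

  replaceColumn-other : ∀ A j v i {k} → k ≢ j → replaceColumn A j v i k ≈ A i k
  replaceColumn-other A j v i {k} k≢j with k ℕ.≟ j
  ... | yes k≡j = ⊥-elim (k≢j k≡j)
  ... | no _ = refl

  replaceColumn-unique : ∀ {M : ℕMatrix} A j v → (∀ i → M i j ≈ v i) → (∀ i {k} → k ≢ j → M i k ≈ A i k) →
    ∀ i k → M i k ≈ replaceColumn A j v i k
  replaceColumn-unique {M} A j v on-column off-column i k = by-cases (k ℕ.≟ j)
    where
    by-cases : Dec (k ≡ j) → M i k ≈ replaceColumn A j v i k
    by-cases (yes Eq.refl) = trans (on-column i) (sym (replaceColumn-same A j v i))
    by-cases (no k≢j) = trans (off-column i k≢j) (sym (replaceColumn-other A j v i k≢j))

  replaceColumn-cong : ∀ A j {v w : ℕ → Carrier} → (∀ i → v i ≈ w i) → ∀ i k →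
    replaceColumn A j v i k ≈ replaceColumn A j w i k
  replaceColumn-cong A j v≈w = replaceColumn-unique A j _
    (λ i → trans (replaceColumn-same A j _ i) (v≈w i)) (λ i k≢j → replaceColumn-other A j _ i k≢j)

  replaceColumn-self : ∀ A j i k → replaceColumn A j (λ i → A i j) i k ≈ A i k
  replaceColumn-self A j i k = sym (replaceColumn-unique A j _ (λ _ → refl) (λ _ _ → refl) i k)

  leadingDet-cong : ∀ n {A B : ℕMatrix} → (∀ i j → j ℕ.< n → A i j ≈ B i j) → leadingDet n A ≈ leadingDet n B
  leadingDet-cong n A≈B = det-cong n (λ i j → A≈B (toℕ i) (toℕ j) (FinP.toℕ<n j))

  leadingDet-linear-column : ∀ {n} A {j} → j ℕ.< n → ∀ x y (u v : ℕ → Carrier) →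
    leadingDet n (replaceColumn A j (λ i → x * u i + y * v i))
      ≈ x * leadingDet n (replaceColumn A j u) + y * leadingDet n (replaceColumn A j v)
  leadingDet-linear-column {n} A {j} j<n x y u v =
    det-linear-column n _ _ _ (Fin.fromℕ< j<n) x y (off u) (off v) on-column
    where
    toℕ-col : toℕ (Fin.fromℕ< j<n) ≡ j
    toℕ-col = FinP.toℕ-fromℕ< j<n
    off : ∀ w i k → k ≢ Fin.fromℕ< j<n →
      replaceColumn A j (λ i → x * u i + y * v i) (toℕ i) (toℕ k) ≈ replaceColumn A j w (toℕ i) (toℕ k)
    off w i k k≢col = trans (replaceColumn-other A j _ (toℕ i) toℕk≢j) (sym (replaceColumn-other A j w (toℕ i) toℕk≢j))
      where
      toℕk≢j : toℕ k ≢ j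
      toℕk≢j e = k≢col (FinP.toℕ-injective (Eq.trans e (Eq.sym toℕ-col)))
    on-column : ∀ i → replaceColumn A j (λ i → x * u i + y * v i) (toℕ i) (toℕ (Fin.fromℕ< j<n))
      ≈ x * replaceColumn A j u (toℕ i) (toℕ (Fin.fromℕ< j<n)) + y * replaceColumn A j v (toℕ i) (toℕ (Fin.fromℕ< j<n))
    on-column i rewrite toℕ-col = trans (replaceColumn-same A j _ (toℕ i))
      (sym (+-cong (*-congˡ (replaceColumn-same A j u (toℕ i))) (*-congˡ (replaceColumn-same A j v (toℕ i)))))

  leadingDet-adjacent-equal-columns : ∀ {n} A {j} → suc j ℕ.< n → (∀ i → A i j ≈ A i (suc j)) → leadingDet n A ≈ 0#
  leadingDet-adjacent-equal-columns {n} A {j} 1+j<n equal =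
    det-adjacent-equal-columns n _ (adjacent-fromℕ p q (Eq.trans toℕ-q (Eq.cong suc (Eq.sym toℕ-p))))
      (λ i → Eq.subst₂ (λ k l → A (toℕ i) k ≈ A (toℕ i) l) (Eq.sym toℕ-p) (Eq.sym toℕ-q) (equal (toℕ i)))
    where
    p = Fin.fromℕ< (ℕP.<-trans (ℕP.n<1+n j) 1+j<n)
    q = Fin.fromℕ< 1+j<n
    toℕ-p = FinP.toℕ-fromℕ< (ℕP.<-trans (ℕP.n<1+n j) 1+j<n)
    toℕ-q = FinP.toℕ-fromℕ< 1+j<n

  adjacentColumns : ℕMatrix → ℕ → (ℕ → Carrier) → (ℕ → Carrier) → ℕMatrix
  adjacentColumns A j u v = replaceColumn (replaceColumn A (suc j) v) j u

  adjacentColumns-swapOrder : ∀ A j u v i k → adjacentColumns A j u v i k ≈ replaceColumn (replaceColumn A j u) (suc j) v i k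
  adjacentColumns-swapOrder A j u v i k = by-cases (k ℕ.≟ j) (k ℕ.≟ suc j)
    where
    j≢1+j = ℕP.<⇒≢ (ℕP.n<1+n j)
    by-cases : Dec (k ≡ j) → Dec (k ≡ suc j) → adjacentColumns A j u v i k ≈ replaceColumn (replaceColumn A j u) (suc j) v i k
    by-cases (yes Eq.refl) _ = trans (replaceColumn-same _ j u i)
      (sym (trans (replaceColumn-other _ (suc j) v i j≢1+j) (replaceColumn-same A j u i)))
    by-cases (no k≢j) (yes Eq.refl) = trans (replaceColumn-other _ j u i k≢j)
      (trans (replaceColumn-same A (suc j) v i) (sym (replaceColumn-same _ (suc j) v i)))
    by-cases (no k≢j) (no k≢1+j) = trans (replaceColumn-other _ j u i k≢j) (trans (replaceColumn-other A (suc j) v i k≢1+j)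
      (sym (trans (replaceColumn-other _ (suc j) v i k≢1+j) (replaceColumn-other A j u i k≢j))))

  -- Bilinear in (u, v) and vanishing for u = v, hence antisymmetric.
  leadingDet-adjacentColumns-antisymmetric : ∀ {n} A {j} → suc j ℕ.< n → ∀ u v →
    leadingDet n (adjacentColumns A j u v) + leadingDet n (adjacentColumns A j v u) ≈ 0#
  leadingDet-adjacentColumns-antisymmetric {n} A {j} 1+j<n u v = begin
    Duv + Dvu
      ≈⟨ solve 4 (λ uu uv vu vv → uv :+ vu := :1 :* (:1 :* uu :+ :1 :* uv) :+ :1 :* (:1 :* vu :+ :1 :* vv) :+ :- uu :+ :- vv)
           refl Duu Duv Dvu Dvv ⟩
    1# * (1# * Duu + 1# * Duv) + 1# * (1# * Dvu + 1# * Dvv) + - Duu + - Dvv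
      ≈⟨ +-cong (+-cong (sym expand) (-‿cong (equal-vanishes u))) (-‿cong (equal-vanishes v)) ⟩
    Dss + - 0# + - 0#
      ≈⟨ +-cong (+-cong (equal-vanishes s) -0#≈0#) -0#≈0# ⟩
    0# + 0# + 0#
      ≈⟨ trans (+-identityʳ _) (+-identityʳ _) ⟩
    0# ∎
    where
    D = λ u v → leadingDet n (adjacentColumns A j u v)
    s = λ i → 1# * u i + 1# * v i
    Duu = D u u
    Duv = D u v
    Dvu = D v u
    Dvv = D v v
    Dss = D s s
    equal-vanishes : ∀ w → D w w ≈ 0#
    equal-vanishes w = leadingDet-adjacent-equal-columns (adjacentColumns A j w w) 1+j<n (λ i →
      trans (replaceColumn-same _ j w i) (sym (trans (replaceColumn-other _ j w i (≢-sym (ℕP.<⇒≢ (ℕP.n<1+n j))))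
                                                     (replaceColumn-same A (suc j) w i))))
    linearˡ : ∀ w → D s w ≈ 1# * D u w + 1# * D v w
    linearˡ w = leadingDet-linear-column (replaceColumn A (suc j) w) (ℕP.<-trans (ℕP.n<1+n j) 1+j<n) 1# 1# u v
    linearʳ : ∀ w → D w s ≈ 1# * D w u + 1# * D w v
    linearʳ w = begin
      D w s
        ≈⟨ leadingDet-cong n (λ i k _ → adjacentColumns-swapOrder A j w s i k) ⟩
      leadingDet n (replaceColumn (replaceColumn A j w) (suc j) s)
        ≈⟨ leadingDet-linear-column (replaceColumn A j w) 1+j<n 1# 1# u v ⟩
      1# * leadingDet n (replaceColumn (replaceColumn A j w) (suc j) u)
        + 1# * leadingDet n (replaceColumn (replaceColumn A j w) (suc j) v)
        ≈⟨ sym (+-cong (*-congˡ (leadingDet-cong n (λ i k _ → adjacentColumns-swapOrder A j w u i k)))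
                       (*-congˡ (leadingDet-cong n (λ i k _ → adjacentColumns-swapOrder A j w v i k)))) ⟩
      1# * D w u + 1# * D w v ∎
    expand : Dss ≈ 1# * (1# * Duu + 1# * Duv) + 1# * (1# * Dvu + 1# * Dvv)
    expand = trans (linearˡ s) (+-cong (*-congˡ (linearʳ u)) (*-congˡ (linearʳ v)))

  -- Moving the copy of column m from column j to column j - 1 only changes the sign.
  leadingDet-equal-columns : ∀ {n} A {m} j → m ℕ.< j → j ℕ.< n → (∀ i → A i m ≈ A i j) → leadingDet n A ≈ 0#
  leadingDet-equal-columns {n} A {m} (suc j) m<1+j 1+j<n equal with ℕP.m≤n⇒m<n∨m≡n (ℕP.≤-pred m<1+j)
  ... | inj₂ Eq.refl = leadingDet-adjacent-equal-columns A 1+j<n equal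
  ... | inj₁ m<j = begin
    leadingDet n A
      ≈⟨ leadingDet-cong n A≈Djm ⟩
    Djm
      ≈⟨ solve 2 (λ x y → x := (x :+ y) :+ :- y) refl Djm Dmj ⟩
    (Djm + Dmj) + - Dmj
      ≈⟨ +-cong (leadingDet-adjacentColumns-antisymmetric A 1+j<n (column j) (column m)) (-‿cong Dmj≈0) ⟩
    0# + - 0#
      ≈⟨ trans (+-identityˡ _) -0#≈0# ⟩
    0# ∎
    where
    column : ℕ → ℕ → Carrier
    column k i = A i k
    Djm = leadingDet n (adjacentColumns A j (column j) (column m))
    Dmj = leadingDet n (adjacentColumns A j (column m) (column j))
    A≈Djm : ∀ i k → k ℕ.< n → A i k ≈ adjacentColumns A j (column j) (column m) i k
    A≈Djm i k _ = by-cases (k ℕ.≟ j) (k ℕ.≟ suc j)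
      where
      by-cases : Dec (k ≡ j) → Dec (k ≡ suc j) → A i k ≈ adjacentColumns A j (column j) (column m) i k
      by-cases (yes Eq.refl) _ = sym (replaceColumn-same _ j _ i)
      by-cases (no k≢j) (yes Eq.refl) = trans (sym (equal i))
        (sym (trans (replaceColumn-other _ j _ i k≢j) (replaceColumn-same A (suc j) _ i)))
      by-cases (no k≢j) (no k≢1+j) = sym (trans (replaceColumn-other _ j _ i k≢j) (replaceColumn-other A (suc j) _ i k≢1+j))
    Dmj≈0 : Dmj ≈ 0#
    Dmj≈0 = leadingDet-equal-columns (adjacentColumns A j (column m) (column j)) j m<j (ℕP.<-trans (ℕP.n<1+n j) 1+j<n)
      (λ i → trans (replaceColumn-other _ j _ i (ℕP.<⇒≢ m<j))
               (trans (replaceColumn-other A (suc j) _ i (ℕP.<⇒≢ m<1+j)) (sym (replaceColumn-same _ j _ i))))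

  leadingDet-add-column : ∀ {n} A {m j} → m ℕ.< j → j ℕ.< n → ∀ x →
    leadingDet n (replaceColumn A j (λ i → A i j + x * A i m)) ≈ leadingDet n A
  leadingDet-add-column {n} A {m} {j} m<j j<n x = begin
    leadingDet n (replaceColumn A j (λ i → A i j + x * A i m))
      ≈⟨ leadingDet-cong n (λ i k _ → replaceColumn-cong A j (λ _ → +-congʳ (sym (*-identityˡ _))) i k) ⟩
    leadingDet n (replaceColumn A j (λ i → 1# * A i j + x * A i m))
      ≈⟨ leadingDet-linear-column A j<n 1# x _ _ ⟩
    1# * leadingDet n (replaceColumn A j (λ i → A i j)) + x * leadingDet n (replaceColumn A j (λ i → A i m))
      ≈⟨ +-cong (*-congˡ (leadingDet-cong n (λ i k _ → replaceColumn-self A j i k)))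
                (*-congˡ (leadingDet-equal-columns (replaceColumn A j (λ i → A i m)) j m<j j<n (λ i →
                   trans (replaceColumn-other A j _ i (ℕP.<⇒≢ m<j)) (sym (replaceColumn-same A j _ i))))) ⟩
    1# * leadingDet n A + x * 0#
      ≈⟨ solve 2 (λ d x → :1 :* d :+ x :* :0 := d) refl (leadingDet n A) x ⟩
    leadingDet n A ∎

  leadingDet-scale-column-mod-earlier : ∀ {n} A {j} k → k ℕ.≤ j → j ℕ.< n → ∀ x (cs : ℕ → Carrier) →
    leadingDet n (replaceColumn A j (λ i → x * A i j + sumTo k (λ m → cs m * A i m))) ≈ x * leadingDet n A
  leadingDet-scale-column-mod-earlier {n} A {j} ℕ.zero _ j<n x cs = begin
    leadingDet n (replaceColumn A j (λ i → x * A i j + 0#))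
      ≈⟨ leadingDet-cong n (λ i k _ → replaceColumn-cong A j (λ _ → +-congˡ (sym (zeroˡ _))) i k) ⟩
    leadingDet n (replaceColumn A j (λ i → x * A i j + 0# * A i j))
      ≈⟨ leadingDet-linear-column A j<n x 0# _ _ ⟩
    x * leadingDet n (replaceColumn A j (λ i → A i j)) + 0# * leadingDet n (replaceColumn A j (λ i → A i j))
      ≈⟨ +-cong (*-congˡ (leadingDet-cong n (λ i k _ → replaceColumn-self A j i k))) (zeroˡ _) ⟩
    x * leadingDet n A + 0#
      ≈⟨ +-identityʳ _ ⟩
    x * leadingDet n A ∎
  leadingDet-scale-column-mod-earlier {n} A {j} (suc k) k<j j<n x cs = begin
    leadingDet n (replaceColumn A j (λ i → x * A i j + sumTo (suc k) (λ m → cs m * A i m)))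
      ≈⟨ leadingDet-cong n (λ i l _ → peel-last i l) ⟩
    leadingDet n (replaceColumn B j (λ i → B i j + cs k * B i k))
      ≈⟨ leadingDet-add-column B k<j j<n (cs k) ⟩
    leadingDet n B
      ≈⟨ leadingDet-scale-column-mod-earlier A k (ℕP.<⇒≤ k<j) j<n x cs ⟩
    x * leadingDet n A ∎
    where
    B = replaceColumn A j (λ i → x * A i j + sumTo k (λ m → cs m * A i m))
    peel-last : ∀ i l → replaceColumn A j (λ i → x * A i j + sumTo (suc k) (λ m → cs m * A i m)) i l
                      ≈ replaceColumn B j (λ i → B i j + cs k * B i k) i l
    peel-last = replaceColumn-unique B j _
      (λ i → trans (replaceColumn-same A j _ i) (trans (sym (+-assoc _ _ _))
        (sym (+-cong (replaceColumn-same A j _ i) (*-congˡ (replaceColumn-other A j _ i (ℕP.<⇒≢ k<j)))))))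
      (λ i l≢j → trans (replaceColumn-other A j _ i l≢j) (sym (replaceColumn-other A j _ i l≢j)))

  leadingDet-lower-triangular : ∀ n A → (∀ i j → i ℕ.< j → A i j ≈ 0#) → leadingDet n A ≈ prodTo n (λ j → A j j)
  leadingDet-lower-triangular ℕ.zero A upper≈0 = refl
  leadingDet-lower-triangular (suc n) A upper≈0 = begin
    leadingDet (suc n) A
      ≈⟨ +-congˡ (sumFin-zero n (λ j → trans (*-congʳ (*-congˡ (upper≈0 0 (suc (toℕ j)) ℕ.z<s)))
                                         (trans (*-congʳ (zeroʳ _)) (zeroˡ _)))) ⟩
    1# * A 0 0 * leadingDet n A′ + 0#
      ≈⟨ trans (+-identityʳ _) (*-congʳ (*-identityˡ _)) ⟩
    A 0 0 * leadingDet n A′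
      ≈⟨ *-congˡ (leadingDet-lower-triangular n A′ (λ i j i<j → upper≈0 (suc i) (suc j) (ℕ.s≤s i<j))) ⟩
    A 0 0 * prodTo n (λ j → A′ j j)
      ≈⟨ sym (prodTo-front n (λ j → A j j)) ⟩
    prodTo (suc n) (λ j → A j j) ∎
    where
    A′ : ℕMatrix
    A′ i k = A (suc i) (suc k)

  record ColumnModEarlier (A : ℕMatrix) (j : ℕ) (x : Carrier) (v : ℕ → Carrier) : Set (c ⊔ ℓ) where
    constructor _,_
    field
      coefficients : ℕ → Carrier
      expansion    : ∀ i → v i ≈ x * A i j + sumTo j (λ m → coefficients m * A i m)

  update : (ℕ → Carrier) → ℕ → Carrier → ℕ → Carrier
  update cs j x m with m ℕ.≟ j
  ... | yes _ = x
  ... | no _ = cs m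

  update-same : ∀ cs j x → update cs j x j ≈ x
  update-same cs j x with j ℕ.≟ j
  ... | yes _ = refl
  ... | no j≢j = ⊥-elim (j≢j Eq.refl)

  update-other : ∀ cs j x {m} → m ≢ j → update cs j x m ≈ cs m
  update-other cs j x {m} m≢j with m ℕ.≟ j
  ... | yes m≡j = ⊥-elim (m≢j m≡j)
  ... | no _ = refl

  columnModEarlier-cong : ∀ {A j x y} {v w : ℕ → Carrier} → x ≈ y → (∀ i → v i ≈ w i) →
    ColumnModEarlier A j x v → ColumnModEarlier A j y w
  columnModEarlier-cong x≈y v≈w (cs , v≈) = cs , λ i → trans (sym (v≈w i)) (trans (v≈ i) (+-congʳ (*-congʳ x≈y)))

  columnModEarlier-self : ∀ A j → ColumnModEarlier A j 1# (λ i → A i j)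
  columnModEarlier-self A j = (λ _ → 0#) , λ i →
    sym (trans (+-cong (*-identityˡ _) (sumTo-zero j (λ m _ → zeroˡ _))) (+-identityʳ _))

  columnModEarlier-zero : ∀ A j → ColumnModEarlier A j 0# (λ _ → 0#)
  columnModEarlier-zero A j = (λ _ → 0#) , λ i →
    sym (trans (+-cong (zeroˡ _) (sumTo-zero j (λ m _ → zeroˡ _))) (+-identityʳ _))

  columnModEarlier-combine : ∀ {A j x y} {v w : ℕ → Carrier} s t →
    ColumnModEarlier A j x v → ColumnModEarlier A j y w →
    ColumnModEarlier A j (s * x + t * y) (λ i → s * v i + t * w i)
  columnModEarlier-combine {A} {j} {x} {y} {v} {w} s t (cs , v≈) (cs′ , w≈) = (λ m → s * cs m + t * cs′ m) , λ i → begin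
    s * v i + t * w i
      ≈⟨ +-cong (*-congˡ (v≈ i)) (*-congˡ (w≈ i)) ⟩
    s * (x * A i j + sumTo j (λ m → cs m * A i m)) + t * (y * A i j + sumTo j (λ m → cs′ m * A i m))
      ≈⟨ solve 7 (λ s t x y a S T → s :* (x :* a :+ S) :+ t :* (y :* a :+ T) := (s :* x :+ t :* y) :* a :+ (s :* S :+ t :* T))
           refl s t x y (A i j) _ _ ⟩
    (s * x + t * y) * A i j + (s * sumTo j (λ m → cs m * A i m) + t * sumTo j (λ m → cs′ m * A i m))
      ≈⟨ +-congˡ (sym (trans (sumTo-cong j (λ m → solve 5 (λ s t c d a → (s :* c :+ t :* d) :* a := s :* (c :* a) :+ t :* (d :* a))
                                                    refl s t (cs m) (cs′ m) (A i m)))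
                             (sumTo-linear j s t _ _))) ⟩
    (s * x + t * y) * A i j + sumTo j (λ m → (s * cs m + t * cs′ m) * A i m) ∎

  columnModEarlier-previous : ∀ {A j x} {v : ℕ → Carrier} → ColumnModEarlier A j x v → ColumnModEarlier A (suc j) 0# v
  columnModEarlier-previous {A} {j} {x} {v} (cs , v≈) = update cs j x , λ i → begin
    v i
      ≈⟨ v≈ i ⟩
    x * A i j + sumTo j (λ m → cs m * A i m)
      ≈⟨ +-comm _ _ ⟩
    sumTo j (λ m → cs m * A i m) + x * A i j
      ≈⟨ sym (+-cong (sumTo-cong< j (λ m m<j → *-congʳ (update-other cs j x (ℕP.<⇒≢ m<j))))
                     (*-congʳ (update-same cs j x))) ⟩
    sumTo (suc j) (λ m → update cs j x m * A i m)
      ≈⟨ sym (trans (+-congʳ (zeroˡ _)) (+-identityˡ _)) ⟩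
    0# * A i (suc j) + sumTo (suc j) (λ m → update cs j x m * A i m) ∎

  columnModEarlier-dot : ∀ {A j} K (w : ℕ → Carrier) {x : ℕ → Carrier} {v : ℕ → ℕ → Carrier} →
    (∀ k → k ℕ.< K → ColumnModEarlier A j (x k) (v k)) → ColumnModEarlier A j (dot K w x) (λ i → dot K w (λ k → v k i))
  columnModEarlier-dot {A} {j} ℕ.zero w _ = columnModEarlier-zero A j
  columnModEarlier-dot (suc K) w v-columns =
    columnModEarlier-cong (+-congʳ (*-identityˡ _)) (λ i → +-congʳ (*-identityˡ _))
      (columnModEarlier-combine 1# (w K)
        (columnModEarlier-dot K w (λ k k<K → v-columns k (ℕP.m<n⇒m<1+n k<K))) (v-columns K ℕP.≤-refl))

  splice : ℕMatrix → ℕMatrix → ℕ → ℕMatrix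
  splice A B t i j with j ℕ.<? t
  ... | yes _ = A i j
  ... | no _ = B i j

  splice-< : ∀ A B {t} i {j} → j ℕ.< t → splice A B t i j ≈ A i j
  splice-< A B {t} i {j} j<t with j ℕ.<? t
  ... | yes _ = refl
  ... | no j≮t = ⊥-elim (j≮t j<t)

  splice-≮ : ∀ A B {t} i {j} → ¬ j ℕ.< t → splice A B t i j ≈ B i j
  splice-≮ A B {t} i {j} j≮t with j ℕ.<? t
  ... | yes j<t = ⊥-elim (j≮t j<t)
  ... | no _ = refl

  -- Replace the columns of B by those of A one at a time, from the left.
  leadingDet-triangular-transform : ∀ n A B (x : ℕ → Carrier) →
    (∀ j → j ℕ.< n → ColumnModEarlier A j (x j) (λ i → B i j)) → leadingDet n B ≈ prodTo n x * leadingDet n A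
  leadingDet-triangular-transform n A B x B-columns =
    trans (stage n ℕP.≤-refl) (*-congˡ (leadingDet-cong n (λ i j j<n → splice-< A B i j<n)))
    where
    stage : ∀ t → t ℕ.≤ n → leadingDet n B ≈ prodTo t x * leadingDet n (splice A B t)
    stage ℕ.zero _ = trans (leadingDet-cong n (λ i j _ → sym (splice-≮ A B {0} i {j} λ ()))) (sym (*-identityˡ _))
    stage (suc t) t<n = begin
      leadingDet n B
        ≈⟨ stage t (ℕP.<⇒≤ t<n) ⟩
      prodTo t x * leadingDet n (splice A B t)
        ≈⟨ *-congˡ (leadingDet-cong n (λ i k _ → next-column i k)) ⟩
      prodTo t x * leadingDet n (replaceColumn S t column)
        ≈⟨ *-congˡ (leadingDet-scale-column-mod-earlier S t ℕP.≤-refl t<n (x t) cs) ⟩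
      prodTo t x * (x t * leadingDet n S)
        ≈⟨ sym (*-assoc _ _ _) ⟩
      prodTo (suc t) x * leadingDet n S ∎
      where
      S = splice A B (suc t)
      cs = ColumnModEarlier.coefficients (B-columns t t<n)
      column = λ i → x t * S i t + sumTo t (λ m → cs m * S i m)
      next-column : ∀ i k → splice A B t i k ≈ replaceColumn S t column i k
      next-column = replaceColumn-unique S t column
        (λ i → trans (splice-≮ A B i (ℕP.<-irrefl Eq.refl)) (trans (ColumnModEarlier.expansion (B-columns t t<n) i)
          (+-cong (*-congˡ (sym (splice-< A B i ℕP.≤-refl)))
                  (sumTo-cong< t (λ m m<t → *-congˡ (sym (splice-< A B i (ℕP.m<n⇒m<1+n m<t))))))))
        (λ i {k} k≢t → by-cases i k≢t (k ℕ.<? t))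
        where
        by-cases : ∀ i {k} → k ≢ t → Dec (k ℕ.< t) → splice A B t i k ≈ S i k
        by-cases i k≢t (yes k<t) = trans (splice-< A B i k<t) (sym (splice-< A B i (ℕP.m<n⇒m<1+n k<t)))
        by-cases i k≢t (no k≮t) = trans (splice-≮ A B i k≮t)
          (sym (splice-≮ A B i (λ k<1+t → k≮t (ℕP.≤∧≢⇒< (ℕP.≤-pred k<1+t) k≢t))))

  inverse-unique : ∀ {x y z} → x * y ≈ 1# → z * x ≈ 1# → y ≈ z
  inverse-unique {x} {y} {z} xy≈1 zx≈1 = begin
    y             ≈⟨ sym (*-identityˡ y) ⟩
    1# * y        ≈⟨ *-congʳ (sym zx≈1) ⟩
    (z * x) * y   ≈⟨ *-assoc z x y ⟩
    z * (x * y)   ≈⟨ *-congˡ xy≈1 ⟩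
    z * 1#        ≈⟨ *-identityʳ z ⟩
    z             ∎

  *-≈-⁻¹ : ∀ {x y z} → x * y ≈ z → ¬ y ≈ 0# → x ≈ z * y ⁻¹
  *-≈-⁻¹ {x} {y} {z} xy≈z y≉0 = begin
    x                ≈⟨ sym (*-identityʳ x) ⟩
    x * 1#           ≈⟨ *-congˡ (sym (inverseʳ y y≉0)) ⟩
    x * (y * y ⁻¹)   ≈⟨ sym (*-assoc _ _ _) ⟩
    (x * y) * y ⁻¹   ≈⟨ *-congʳ xy≈z ⟩
    z * y ⁻¹         ∎

  *-≉0 : ∀ {x y} → ¬ x ≈ 0# → ¬ y ≈ 0# → ¬ x * y ≈ 0#
  *-≉0 x≉0 y≉0 xy≈0 = x≉0 (trans (*-≈-⁻¹ xy≈0 y≉0) (zeroˡ _))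

  pow-≉0 : ∀ {x} k → ¬ x ≈ 0# → ¬ pow x k ≈ 0#
  pow-≉0 ℕ.zero x≉0 1≈0 = 0≉1 (sym 1≈0)
  pow-≉0 (suc k) x≉0 = *-≉0 (pow-≉0 k x≉0) x≉0

  -‿≉0 : ∀ {x} → ¬ x ≈ 0# → ¬ - x ≈ 0#
  -‿≉0 {x} x≉0 -x≈0 = x≉0 (trans (sym (-‿involutive x)) (trans (-‿cong -x≈0) -0#≈0#))

  pow-cong : ∀ k {x y} → x ≈ y → pow x k ≈ pow y k
  pow-cong ℕ.zero x≈y = refl
  pow-cong (suc k) x≈y = *-cong (pow-cong k x≈y) x≈y

  pow-* : ∀ k x y → pow x k * pow y k ≈ pow (x * y) k
  pow-* ℕ.zero x y = *-identityʳ 1#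
  pow-* (suc k) x y = trans
    (solve 4 (λ p x q y → (p :* x) :* (q :* y) := (p :* q) :* (x :* y)) refl (pow x k) x (pow y k) y)
    (*-congʳ (pow-* k x y))

  pow-negQuotient-⁻¹ : ∀ k {x y z} → ¬ y ≈ 0# → ¬ z ≈ 0# →
    pow (- (x * y ⁻¹)) k * z ⁻¹ ≈ pow x k * (pow (- y) k * z) ⁻¹
  pow-negQuotient-⁻¹ k {x} {y} {z} y≉0 z≉0 = *-≈-⁻¹ (begin
    (pow (- (x * y ⁻¹)) k * z ⁻¹) * (pow (- y) k * z)
      ≈⟨ solve 4 (λ R Q M p → (R :* Q) :* (M :* p) := (R :* M) :* (p :* Q))
           refl (pow (- (x * y ⁻¹)) k) (z ⁻¹) (pow (- y) k) z ⟩
    (pow (- (x * y ⁻¹)) k * pow (- y) k) * (z * z ⁻¹)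
      ≈⟨ *-cong (pow-* k _ _) (inverseʳ z z≉0) ⟩
    pow (- (x * y ⁻¹) * - y) k * 1#
      ≈⟨ trans (*-identityʳ _) (pow-cong k quotient-cancels) ⟩
    pow x k ∎) (*-≉0 (pow-≉0 k (-‿≉0 y≉0)) z≉0)
    where
    quotient-cancels : - (x * y ⁻¹) * - y ≈ x
    quotient-cancels = begin
      - (x * y ⁻¹) * - y ≈⟨ solve 3 (λ x I y → :- (x :* I) :* :- y := x :* (y :* I)) refl x (y ⁻¹) y ⟩
      x * (y * y ⁻¹)     ≈⟨ *-congˡ (inverseʳ y y≉0) ⟩
      x * 1#             ≈⟨ *-identityʳ x ⟩
      x                  ∎

  module ThreeTermRecurrence (b a lam : ℕ → Carrier) where

    cP : ℕ → ℕ → Carrier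
    cP = coeffP b a lam

    cP₋₁ : ℕ → ℕ → Carrier
    cP₋₁ j = proj₁ (coeffPair b a lam j)

    coeffPair-degree : ∀ j → (∀ k → j ℕ.≤ k → cP₋₁ j k ≈ 0#) × (∀ k → j ℕ.< k → cP j k ≈ 0#)
    coeffPair-degree ℕ.zero = (λ _ _ → refl) , λ { (suc k) _ → refl }
    coeffPair-degree (suc j) = proj₂ (coeffPair-degree j) , vanish
      where
      q-vanish = proj₂ (coeffPair-degree j)
      p-vanish = proj₁ (coeffPair-degree j)
      vanish : ∀ k → suc j ℕ.< k → cP (suc j) k ≈ 0#
      vanish (suc k) (ℕ.s≤s j<k) = begin
        (cP j k + - (b j * cP j (suc k))) + - (a j * cP₋₁ j k + lam j * cP₋₁ j (suc k))
          ≈⟨ +-cong (+-cong (q-vanish k j<k) (-‿cong (*-congˡ (q-vanish (suc k) (ℕP.m<n⇒m<1+n j<k)))))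
                    (-‿cong (+-cong (*-congˡ (p-vanish k (ℕP.<⇒≤ j<k)))
                                    (*-congˡ (p-vanish (suc k) (ℕP.<⇒≤ (ℕP.m<n⇒m<1+n j<k)))))) ⟩
        (0# + - (b j * 0#)) + - (a j * 0# + lam j * 0#)
          ≈⟨ solve 3 (λ x y z → (:0 :+ :- (x :* :0)) :+ :- (y :* :0 :+ z :* :0) := :0)
               refl (b j) (a j) (lam j) ⟩
        0# ∎

    cP-degree : ∀ j k → j ℕ.< k → cP j k ≈ 0#
    cP-degree j = proj₂ (coeffPair-degree j)

    cP₋₁-degree : ∀ j k → j ℕ.≤ k → cP₋₁ j k ≈ 0#
    cP₋₁-degree j = proj₁ (coeffPair-degree j)

    -- Pairing the recurrence P_{j+1} = (x - b_j) P_j - (a_j x + lam_j) P_{j-1} against any f.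
    dot-cP-suc : ∀ K j f →
      dot K (cP (suc j)) f ≈ ((dot K (shift (cP j)) f + (- b j) * dot K (cP j) f)
                               + (- a j) * dot K (shift (cP₋₁ j)) f) + (- lam j) * dot K (cP₋₁ j) f
    dot-cP-suc K j f = begin
      dot K (cP (suc j)) f
        ≈⟨ sumTo-cong K (λ k → *-congʳ (solve 7 (λ s B q A t L p →
             (s :+ :- (B :* q)) :+ :- (A :* t :+ L :* p)
             := :1 :* (:1 :* (:1 :* s :+ (:- B) :* q) :+ (:- A) :* t) :+ (:- L) :* p)
             refl (shift q k) (b j) (q k) (a j) (shift p k) (lam j) (p k))) ⟩
      dot K (λ k → 1# * (1# * (1# * shift q k + (- b j) * q k) + (- a j) * shift p k) + (- lam j) * p k) f
        ≈⟨ trans (dot-linearˡ K 1# (- lam j) _ p f) (+-congʳ (*-congˡ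
             (trans (dot-linearˡ K 1# (- a j) _ (shift p) f) (+-congʳ (*-congˡ (dot-linearˡ K 1# (- b j) (shift q) q f)))))) ⟩
      1# * (1# * (1# * dot K (shift q) f + (- b j) * dot K q f) + (- a j) * dot K (shift p) f) + (- lam j) * dot K p f
        ≈⟨ solve 7 (λ S B Q A T L R →
             :1 :* (:1 :* (:1 :* S :+ B :* Q) :+ A :* T) :+ L :* R
             := ((S :+ B :* Q) :+ A :* T) :+ L :* R)
             refl (dot K (shift q) f) (- b j) (dot K q f) (- a j) (dot K (shift p) f) (- lam j) (dot K p f) ⟩
      ((dot K (shift q) f + (- b j) * dot K q f) + (- a j) * dot K (shift p) f) + (- lam j) * dot K p f ∎
      where
      q = cP j
      p = cP₋₁ j

    dot-pow-suc : ∀ K w x → dot K w (λ k → pow x (suc k)) ≈ x * dot K w (pow x)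
    dot-pow-suc K w x = trans
      (sumTo-cong K (λ k → solve 3 (λ u p x → u :* (p :* x) := x :* (u :* p)) refl (w k) (pow x k) x))
      (sumTo-scale K x _)

    evaluate-coeffPair : ∀ x j → dot j (cP₋₁ j) (pow x) ≈ proj₁ (evalPair b a lam j x)
                                × dot (suc j) (cP j) (pow x) ≈ P b a lam j x
    evaluate-coeffPair x ℕ.zero = refl , trans (+-identityˡ _) (*-identityˡ _)
    evaluate-coeffPair x (suc j) = proj₂ (evaluate-coeffPair x j) , (begin
      dot (2 +ℕ j) (cP (suc j)) (pow x)
        ≈⟨ dot-cP-suc (2 +ℕ j) j (pow x) ⟩
      ((dot (2 +ℕ j) (shift q) (pow x) + (- b j) * dot (2 +ℕ j) q (pow x))
        + (- a j) * dot (2 +ℕ j) (shift p) (pow x)) + (- lam j) * dot (2 +ℕ j) p (pow x)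
        ≈⟨ +-cong (+-cong (+-cong (trans (dot-shift (suc j) q (pow x)) (dot-pow-suc (suc j) q x))
                                  (*-congˡ (dot-extend 1 (suc j) q (pow x) (cP-degree j))))
                          (*-congˡ (trans (dot-shift (suc j) p (pow x)) (trans (dot-pow-suc (suc j) p x)
                                     (*-congˡ (dot-extend 1 j p (pow x) (cP₋₁-degree j)))))))
                  (*-congˡ (dot-extend 2 j p (pow x) (cP₋₁-degree j))) ⟩
      ((x * dot (suc j) q (pow x) + (- b j) * dot (suc j) q (pow x)) + (- a j) * (x * dot j p (pow x)))
        + (- lam j) * dot j p (pow x)
        ≈⟨ +-cong (+-cong (+-cong (*-congˡ Pj) (*-congˡ Pj)) (*-congˡ (*-congˡ Pj₋₁))) (*-congˡ Pj₋₁) ⟩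
      ((x * P b a lam j x + (- b j) * P b a lam j x) + (- a j) * (x * Pj₋₁x)) + (- lam j) * Pj₋₁x
        ≈⟨ solve 6 (λ x B A L Q R → ((x :* Q :+ (:- B) :* Q) :+ (:- A) :* (x :* R)) :+ (:- L) :* R
             := (x :+ :- B) :* Q :+ :- ((A :* x :+ L) :* R))
             refl x (b j) (a j) (lam j) (P b a lam j x) Pj₋₁x ⟩
      P b a lam (suc j) x ∎)
      where
      q = cP j
      p = cP₋₁ j
      Pj₋₁x = proj₁ (evalPair b a lam j x)
      Pj = proj₂ (evaluate-coeffPair x j)
      Pj₋₁ = proj₁ (evaluate-coeffPair x j)

    module Moments (ν : ℕ → ℕ → Carrier) (a≉0 : ∀ n → ¬ (a (suc n) ≈ 0#))
                   (isMoment : IsMomentFunctional b a lam ν) where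
      open IsMomentFunctional isMoment

      -- the zero -lam_j / a_j of a_j x + lam_j
      r : ℕ → Carrier
      r j = - (lam j * a j ⁻¹)

      ν-step : ∀ n m → ν (suc n) (suc m) ≈ a (suc m) ⁻¹ * ν n m + r (suc m) * ν n (suc m)
      ν-step n m = sym (begin
        A⁻¹ * ν n m + r (suc m) * y
          ≈⟨ +-congʳ (*-congˡ (consistent n m)) ⟩
        A⁻¹ * (A * x + L * y) + - (L * A⁻¹) * y
          ≈⟨ solve 5 (λ A⁻¹ A L x y → A⁻¹ :* (A :* x :+ L :* y) :+ :- (L :* A⁻¹) :* y := (A :* A⁻¹) :* x)
               refl A⁻¹ A L x y ⟩
        (A * A⁻¹) * x
          ≈⟨ *-congʳ (inverseʳ A (a≉0 m)) ⟩
        1# * x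
          ≈⟨ *-identityˡ x ⟩
        x ∎)
        where
        A = a (suc m)
        A⁻¹ = a (suc m) ⁻¹
        L = lam (suc m)
        x = ν (suc n) (suc m)
        y = ν n (suc m)

      -- x^k / d_j ≡ r_j^k / d_j modulo 1/d_0, ..., 1/d_(j-1) for k ≤ j (partial fractions).
      ν-power : ∀ k j → k ℕ.≤ j → ColumnModEarlier ν j (pow (r j) k) (λ i → ν (i +ℕ k) j)
      ν-power ℕ.zero j _ =
        columnModEarlier-cong refl (λ i → reflexive (Eq.cong (λ n → ν n j) (Eq.sym (ℕP.+-identityʳ i))))
          (columnModEarlier-self ν j)
      ν-power (suc k) (suc j) (ℕ.s≤s k≤j) = columnModEarlier-cong leading next
        (columnModEarlier-combine (a (suc j) ⁻¹) (r (suc j))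
          (columnModEarlier-previous (ν-power k j k≤j)) (ν-power k (suc j) (ℕP.m≤n⇒m≤1+n k≤j)))
        where
        leading : a (suc j) ⁻¹ * 0# + r (suc j) * pow (r (suc j)) k ≈ pow (r (suc j)) (suc k)
        leading = trans (+-congʳ (zeroʳ _)) (trans (+-identityˡ _) (*-comm _ _))
        next : ∀ i → a (suc j) ⁻¹ * ν (i +ℕ k) j + r (suc j) * ν (i +ℕ k) (suc j) ≈ ν (i +ℕ suc k) (suc j)
        next i = trans (sym (ν-step (i +ℕ k) j)) (reflexive (Eq.cong (λ n → ν n (suc j)) (Eq.sym (ℕP.+-suc i k))))

      -- L(x^n w(x) / d_m), for a polynomial w with K coefficients
      moment : ℕ → (ℕ → Carrier) → ℕ → ℕ → Carrier
      moment K w n m = dot K w (λ k → ν (n +ℕ k) m)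

      LQ : ℕ → ℕ → Carrier
      LQ n m = moment (suc m) (cP m) n m

      moment-consistent : ∀ K w n m →
        moment K w n m ≈ a (suc m) * moment K w (suc n) (suc m) + lam (suc m) * moment K w n (suc m)
      moment-consistent K w n m = trans (dot-congʳ K w (λ k → consistent (n +ℕ k) m)) (dot-linearʳ K _ _ w _ _)

      moment-shift : ∀ K w n m → moment (suc K) (shift w) n m ≈ moment K w (suc n) m
      moment-shift K w n m = trans (dot-shift K w _)
        (dot-congʳ K w (λ k → reflexive (Eq.cong (λ l → ν l m) (ℕP.+-suc n k))))

      -- Integrate x^n (a_{m+1} x + lam_{m+1}) Q_{m+1} = x^n ((x - b_m) Q_m - Q_{m-1}) against L;
      -- the left side vanishes by orthogonality.
      LQ-recurrence : ∀ m′ n → n ℕ.< suc m′ → LQ (suc n) (suc m′) ≈ b (suc m′) * LQ n (suc m′) + LQ n m′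
      LQ-recurrence m′ n n<m = begin
        LQ (suc n) m
          ≈⟨ solve 4 (λ X B Y Z → X := B :* Y :+ Z :+ ((X :+ (:- B) :* Y) :+ :- Z)) refl (LQ (suc n) m) (b m) (LQ n m) (LQ n m′) ⟩
        b m * LQ n m + LQ n m′ + ((LQ (suc n) m + (- b m) * LQ n m) + - LQ n m′)
          ≈⟨ +-congˡ (trans (sym expanded) vanishes) ⟩
        b m * LQ n m + LQ n m′ + 0#
          ≈⟨ +-identityʳ _ ⟩
        b m * LQ n m + LQ n m′ ∎
        where
        m = suc m′
        p = cP m′
        T = moment (suc (suc m)) (cP (suc m)) n m
        vanishes : T ≈ 0#
        vanishes = begin
          T
            ≈⟨ moment-consistent (suc (suc m)) (cP (suc m)) n m ⟩
          a (suc m) * LQ (suc n) (suc m) + lam (suc m) * LQ n (suc m)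
            ≈⟨ +-cong (*-congˡ (orthogonal (suc n) (suc m) (ℕ.s≤s n<m))) (*-congˡ (orthogonal n (suc m) (ℕP.m<n⇒m<1+n n<m))) ⟩
          a (suc m) * 0# + lam (suc m) * 0#
            ≈⟨ trans (+-cong (zeroʳ _) (zeroʳ _)) (+-identityʳ _) ⟩
          0# ∎
        previous : (- a m) * moment m p (suc n) m + (- lam m) * moment m p n m ≈ - LQ n m′
        previous = begin
          (- a m) * moment m p (suc n) m + (- lam m) * moment m p n m
            ≈⟨ solve 4 (λ A X L Y → (:- A) :* X :+ (:- L) :* Y := :- (A :* X :+ L :* Y))
                 refl (a m) (moment m p (suc n) m) (lam m) (moment m p n m) ⟩
          - (a m * moment m p (suc n) m + lam m * moment m p n m)
            ≈⟨ -‿cong (sym (moment-consistent m p n m′)) ⟩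
          - LQ n m′ ∎
        expanded : T ≈ (LQ (suc n) m + (- b m) * LQ n m) + - LQ n m′
        expanded = begin
          T
            ≈⟨ dot-cP-suc (suc (suc m)) m _ ⟩
          ((moment (suc (suc m)) (shift (cP m)) n m + (- b m) * moment (suc (suc m)) (cP m) n m)
            + (- a m) * moment (suc (suc m)) (shift p) n m) + (- lam m) * moment (suc (suc m)) p n m
            ≈⟨ +-cong (+-cong (+-cong (moment-shift (suc m) (cP m) n m)
                                      (*-congˡ (dot-extend 1 (suc m) (cP m) _ (cP-degree m))))
                              (*-congˡ (trans (moment-shift (suc m) p n m) (dot-extend 1 m p _ (cP₋₁-degree m)))))
                      (*-congˡ (dot-extend 2 m p _ (cP₋₁-degree m))) ⟩
          ((LQ (suc n) m + (- b m) * LQ n m) + (- a m) * moment m p (suc n) m) + (- lam m) * moment m p n m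
            ≈⟨ trans (+-assoc _ _ _) (+-congˡ previous) ⟩
          (LQ (suc n) m + (- b m) * LQ n m) + - LQ n m′ ∎

      LQ-diagonal : ∀ m → LQ m m ≈ 1#
      LQ-diagonal ℕ.zero = trans (+-identityˡ _) (trans (*-identityˡ _) normalised)
      LQ-diagonal (suc m′) = begin
        LQ (suc m′) (suc m′)
          ≈⟨ LQ-recurrence m′ m′ ℕP.≤-refl ⟩
        b (suc m′) * LQ m′ (suc m′) + LQ m′ m′
          ≈⟨ +-cong (*-congˡ (orthogonal m′ (suc m′) ℕP.≤-refl)) (LQ-diagonal m′) ⟩
        b (suc m′) * 0# + 1#
          ≈⟨ trans (+-congʳ (zeroʳ _)) (+-identityˡ _) ⟩
        1# ∎

      Pr : ℕ → Carrier
      Pr j = P b a lam j (r j)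

      LQ-column : ∀ j → ColumnModEarlier ν j (Pr j) (λ i → LQ i j)
      LQ-column j = columnModEarlier-cong (proj₂ (evaluate-coeffPair (r j) j)) (λ _ → refl)
        (columnModEarlier-dot (suc j) (cP j) (λ k k<1+j → ν-power k j (ℕP.≤-pred k<1+j)))

      det-LQ : ∀ n → leadingDet n LQ ≈ 1#
      det-LQ n = trans (leadingDet-lower-triangular n LQ orthogonal) (prodTo-one n LQ-diagonal)

      det-LQ-factor : ∀ n → leadingDet n LQ ≈ prodTo n Pr * leadingDet n ν
      det-LQ-factor n = leadingDet-triangular-transform n ν LQ Pr (λ j _ → LQ-column j)

      det-Hankel-factor : ∀ n →
        leadingDet n (λ i j → ν (i +ℕ j) j) ≈ prodTo n (λ j → pow (r j) j) * leadingDet n ν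
      det-Hankel-factor n = leadingDet-triangular-transform n ν _ _ (λ j _ → ν-power j j ℕP.≤-refl)

      module _ (Pr≉0 : ∀ n → ¬ Pr (suc n) ≈ 0#) (n : ℕ) where

        det-ν : leadingDet (suc n) ν ≈ prod1 n (λ k → Pr k ⁻¹)
        det-ν = inverse-unique (begin
          prod1 n Pr * leadingDet (suc n) ν        ≈⟨ *-congʳ (sym (*-identityˡ _)) ⟩
          1# * prod1 n Pr * leadingDet (suc n) ν   ≈⟨ *-congʳ (sym (prodTo-suc n Pr)) ⟩
          prodTo (suc n) Pr * leadingDet (suc n) ν ≈⟨ sym (det-LQ-factor (suc n)) ⟩
          leadingDet (suc n) LQ                    ≈⟨ det-LQ (suc n) ⟩
          1#                                       ∎) (prod1-inverse n Pr≉0)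

        det-Hankel : leadingDet (suc n) (λ i j → ν (i +ℕ j) j)
          ≈ prod1 n (λ k → pow (lam k) k * (pow (- a k) k * Pr k) ⁻¹)
        det-Hankel = begin
          leadingDet (suc n) (λ i j → ν (i +ℕ j) j)
            ≈⟨ det-Hankel-factor (suc n) ⟩
          prodTo (suc n) (λ j → pow (r j) j) * leadingDet (suc n) ν
            ≈⟨ *-cong (prodTo-suc n _) det-ν ⟩
          (1# * prod1 n (λ k → pow (r k) k)) * prod1 n (λ k → Pr k ⁻¹)
            ≈⟨ trans (*-congʳ (*-identityˡ _)) (prod1-* n _ _) ⟩
          prod1 n (λ k → pow (r k) k * Pr k ⁻¹)
            ≈⟨ prod1-cong n (λ k → pow-negQuotient-⁻¹ (suc k) (a≉0 k) (Pr≉0 k)) ⟩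
          prod1 n (λ k → pow (lam k) k * (pow (- a k) k * Pr k) ⁻¹) ∎

theorem6p7 : {c ℓ : Level} (F : Field c ℓ) →
  let open Field F
      open FieldDefs F
  in (b a lam : ℕ → Carrier) (ν : ℕ → ℕ → Carrier) →
     (∀ n → ¬ (a (suc n) ≈ 0#)) →
     (∀ n → ¬ (P b a lam (suc n) (- (lam (suc n) * a (suc n) ⁻¹)) ≈ 0#)) →
     IsMomentFunctional b a lam ν →
     (∀ n → ¬ (det (suc n) (λ i j → ν (toℕ i +ℕ toℕ j) n) ≈ 0#)) →
     ∀ n →
       (det (suc n) (λ i j → ν (toℕ i +ℕ toℕ j) (toℕ j))
          ≈ prod1 n (λ k → pow (lam k) k
               * (pow (- (a k)) k * P b a lam k (- (lam k * a k ⁻¹))) ⁻¹))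
       × (det (suc n) (λ i j → ν (toℕ i) (toℕ j))
          ≈ prod1 n (λ k → (P b a lam k (- (lam k * a k ⁻¹))) ⁻¹))
theorem6p7 F b a lam ν a≉0 Pr≉0 isMoment _ n = det-Hankel Pr≉0 n , det-ν Pr≉0 n
  where
  open Development F
  open ThreeTermRecurrence b a lam
  open Moments ν a≉0 isMoment
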